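{- Let $\mathbf{L}\in\mathbf{RDMSH_1}$ and $x,y\in L$. Then $x\wedge(x^+\vee y\vee y^*)=x\wedge(y\vee y^*)$.
   Context: A semi-Heyting algebra is an algebra $\langle L,\vee,\wedge,\to,0,1\rangle$ such that $\langle L,\vee,\wedge,0,1\rangle$ is a bounded lattice and the identities $x\wedge(x\to y)\approx x\wedge y$, $x\wedge(y\to z)\approx x\wedge((x\wedge y)\to(x\wedge z))$ and $x\to x\approx 1$ hold; write $x^*:=x\to 0$. A De Morgan semi-Heyting algebra is an expansion $\langle L,\vee,\wedge,\to,',0,1\rangle$ of a semi-Heyting algebra by a unary operation $'$ satisfying $0'\approx 1$, $1'\approx 0$, $(x\wedge y)'\approx x'\vee y'$, $(x\vee y)''\approx x''\vee y''$ and $x''\approx x$. Notation: $x'^*:=(x')^*$ and $x^+:=((x')^*)'$. Such an algebra has level 1 if it satisfies $((x\wedge x'^*)')^*\approx x\wedge x'^*$, and it is regular if it satisfies $x\wedge x^+\le y\vee y^*$. $\mathbf{RDMSH_1}$ is the variety of regular De Morgan semi-Heyting algebras of level 1. -}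

module Defs where

open import Level using (Level; suc)
open import Relation.Binary.PropositionalEquality using (_≡_)
open import Algebra.Core using (Op₁; Op₂)
open import Algebra.Lattice.Structures using (IsLattice)

-- Lattice order: x ≤ y iff x ∧ y = x
record RDMSH₁ (c : Level) : Set (suc c) where
  infixr 6 _∨_
  infixr 7 _∧_
  infixr 5 _⇒_
  field
    Carrier : Set c
    _∨_ _∧_ _⇒_ : Op₂ Carrier
    ′ : Op₁ Carrier
    ⊥ ⊤ : Carrier
    isLattice : IsLattice _≡_ _∨_ _∧_
    ∨-identityˡ : ∀ x → ⊥ ∨ x ≡ x
    ∧-identityˡ : ∀ x → ⊤ ∧ x ≡ x
    sh1 : ∀ x y → x ∧ (x ⇒ y) ≡ x ∧ y
    sh2 : ∀ x y z → x ∧ (y ⇒ z) ≡ x ∧ ((x ∧ y) ⇒ (x ∧ z))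
    sh3 : ∀ x → x ⇒ x ≡ ⊤
    dm0 : ′ ⊥ ≡ ⊤
    dm1 : ′ ⊤ ≡ ⊥
    dm∧ : ∀ x y → ′ (x ∧ y) ≡ ′ x ∨ ′ y
    dm∨ : ∀ x y → ′ (′ (x ∨ y)) ≡ ′ (′ x) ∨ ′ (′ y)
    dm′′ : ∀ x → ′ (′ x) ≡ x
    -- level 1, with x* := x ⇒ ⊥
    level1 : ∀ x → ′ (x ∧ (′ x ⇒ ⊥)) ⇒ ⊥ ≡ x ∧ (′ x ⇒ ⊥)
    -- regularity: x ∧ x⁺ ≤ y ∨ y*, with x⁺ := ((x′)*)′
    regular : ∀ x y → (x ∧ ′ (′ x ⇒ ⊥)) ∧ (y ∨ (y ⇒ ⊥)) ≡ x ∧ ′ (′ x ⇒ ⊥)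

  _* : Op₁ Carrier
  x * = x ⇒ ⊥

  _⁺ : Op₁ Carrier
  x ⁺ = ′ ((′ x) *)

-- Although the axioms only ask for a lattice, a semi-Heyting algebra is distributive:
-- x ∧ y ≤ w implies y ≤ x ⇒ (x ∧ w), and x ∧ (x ⇒ (x ∧ w)) = x ∧ w, so x ∧ _ preserves
-- binary joins. Distributing x over x⁺ ∨ (y ∨ y*) gives (x ∧ x⁺) ∨ (x ∧ (y ∨ y*)), and
-- regularity says exactly that the first joinand lies below the second.
module Submission where

open import Defs
open import Level using (Level)
open import Relation.Binary.PropositionalEquality using (_≡_; sym; trans; cong; module ≡-Reasoning)
open import Algebra.Lattice.Bundles using (Lattice)
open import Algebra.Lattice.Structures using (IsLattice)
import Algebra.Lattice.Properties.Lattice as LatticeProperties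
import Relation.Binary.Lattice as OrderTheoretic
import Relation.Binary.Lattice.Properties.JoinSemilattice as JoinSemilatticeProperties
import Relation.Binary.Lattice.Properties.MeetSemilattice as MeetSemilatticeProperties
import Relation.Binary.Reasoning.PartialOrder as ≤-Reasoning

module RDMSH₁-Properties {c : Level} (L : RDMSH₁ c) where
  open RDMSH₁ L
  open IsLattice isLattice using (∧-comm; ∧-assoc)

  lattice : Lattice c c
  lattice = record { isLattice = isLattice }

  open LatticeProperties lattice using (∧-idem; ∨-∧-orderTheoreticLattice)
  -- Here x ≤ y unfolds to x ≡ x ∧ y, which the equational proofs below use directly.
  open OrderTheoretic.Lattice ∨-∧-orderTheoreticLattice
    using (_≤_; poset; joinSemilattice; meetSemilattice; antisym;
           x≤x∨y; y≤x∨y; ∨-least; x∧y≤x; x∧y≤y; ∧-greatest)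
    renaming (refl to ≤-refl)
  open JoinSemilatticeProperties joinSemilattice using (x≤y⇒x∨y≈y)
  open MeetSemilatticeProperties meetSemilattice using (∧-monotonic)

  ∧-identityʳ : ∀ x → x ∧ ⊤ ≡ x
  ∧-identityʳ x = trans (∧-comm x ⊤) (∧-identityˡ x)

  ∧-⇒-∧ : ∀ x z → x ∧ (x ⇒ x ∧ z) ≡ x ∧ z
  ∧-⇒-∧ x z = begin
    x ∧ (x ⇒ x ∧ z)  ≡⟨ sh1 x (x ∧ z) ⟩
    x ∧ (x ∧ z)      ≡⟨ ∧-assoc x x z ⟨
    (x ∧ x) ∧ z      ≡⟨ cong (_∧ z) (∧-idem x) ⟩
    x ∧ z            ∎
    where open ≡-Reasoning

  transpose-⇒ : ∀ {x y z} → x ∧ y ≤ z → y ≤ x ⇒ x ∧ z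
  transpose-⇒ {x} {y} {z} x∧y≤z = sym (begin
    y ∧ (x ⇒ x ∧ z)              ≡⟨ sh2 y x (x ∧ z) ⟩
    y ∧ (y ∧ x ⇒ y ∧ (x ∧ z))    ≡⟨ cong (λ t → y ∧ (y ∧ x ⇒ t)) y∧[x∧z]≡y∧x ⟩
    y ∧ (y ∧ x ⇒ y ∧ x)          ≡⟨ cong (y ∧_) (sh3 (y ∧ x)) ⟩
    y ∧ ⊤                        ≡⟨ ∧-identityʳ y ⟩
    y                            ∎)
    where
    open ≡-Reasoning
    y∧[x∧z]≡y∧x : y ∧ (x ∧ z) ≡ y ∧ x
    y∧[x∧z]≡y∧x = begin
      y ∧ (x ∧ z)  ≡⟨ ∧-assoc y x z ⟨
      (y ∧ x) ∧ z  ≡⟨ cong (_∧ z) (∧-comm y x) ⟩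
      (x ∧ y) ∧ z  ≡⟨ x∧y≤z ⟨
      x ∧ y        ≡⟨ ∧-comm x y ⟩
      y ∧ x        ∎

  ∧-distribˡ-∨ : ∀ x y z → x ∧ (y ∨ z) ≡ x ∧ y ∨ x ∧ z
  ∧-distribˡ-∨ x y z = antisym ≤-distrib ≥-distrib
    where
    open ≤-Reasoning poset
    w : Carrier
    w = x ∧ y ∨ x ∧ z
    ≤-distrib : x ∧ (y ∨ z) ≤ w
    ≤-distrib = begin
      x ∧ (y ∨ z)      ≤⟨ ∧-monotonic ≤-refl
                            (∨-least (transpose-⇒ (x≤x∨y _ _)) (transpose-⇒ (y≤x∨y _ _))) ⟩
      x ∧ (x ⇒ x ∧ w)  ≡⟨ ∧-⇒-∧ x w ⟩
      x ∧ w            ≤⟨ x∧y≤y x w ⟩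
      w                ∎
    ≥-distrib : w ≤ x ∧ (y ∨ z)
    ≥-distrib = ∨-least (∧-monotonic ≤-refl (x≤x∨y y z)) (∧-monotonic ≤-refl (y≤x∨y y z))

  ∧-∨-absorbs-≤ : ∀ {x u v} → x ∧ u ≤ v → x ∧ (u ∨ v) ≡ x ∧ v
  ∧-∨-absorbs-≤ {x} {u} {v} x∧u≤v = trans (∧-distribˡ-∨ x u v)
    (x≤y⇒x∨y≈y (∧-greatest (x∧y≤x x u) x∧u≤v))

lemma3p4 : ∀ {c : Level} (L : RDMSH₁ c) → let open RDMSH₁ L in
    ∀ x y → x ∧ (x ⁺ ∨ y ∨ y *) ≡ x ∧ (y ∨ y *)
lemma3p4 L x y = ∧-∨-absorbs-≤ (sym (regular x y))
  where
  open RDMSH₁ L using (regular)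
  open RDMSH₁-Properties L using (∧-∨-absorbs-≤)
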